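{- Let $M=\langle Q,\Gamma,\delta\rangle$ be a machine with designated state $q_r$. If a fact set $F$ has a wild frontier of a configuration $\rho$ overseen by a term $w$, and $\rho'\in\mathrm{Next}_M(\rho)$, then there exists a restricted chase derivation $F,\dots,F'$ for the rule set $\Sigma_M$ starting from $F$ such that $F'$ has a wild frontier of $\rho'$ overseen by $w'$, where $w'\neq w$ is a freshly introduced null if the state of $\rho$ is $q_r$, and $w'=w$ otherwise.
   Context: Machines: $M=\langle Q,\Gamma,\delta\rangle$, initial state $q_0$, $\Gamma\supseteq\{0,1\}$, blank $\mathtt B\notin\Gamma$, $\delta:Q\times(\Gamma\cup\{\mathtt B\})\to\mathcal P(Q\times\Gamma\times\{\leftarrow,\rightarrow\})$. Configurations $\langle n,t,p,q\rangle$: $t:\{1..n\}\to\Gamma\cup\{\mathtt B\}$, $t(n)=\mathtt B$, blanks only at the end, $1\le p\le n$, $q\in Q$. $\mathrm{Next}_M(\langle n,t,p,q\rangle)$ contains for each $\langle r,a,d\rangle\in\delta(q,t(p))$ with $d=\rightarrow$ or $p\ge2$ the configuration $\langle n+1,t',p\pm1,r\rangle$ ($-$ iff $d=\leftarrow$) with $t'(p)=a$, $t'(n+1)=\mathtt B$, $t'(i)=t(i)$ otherwise. Chase: trigger $\langle R,\sigma\rangle$ loaded for $F$ if $\sigma(\mathrm{body}(R))\subseteq F$, obsolete if some extension to existential variables maps $\mathrm{head}(R)$ into $F$; output maps existential variables to fresh nulls. A restricted chase derivation from $F$ is a sequence $F=G_0,G_1,\dots$ with $G_{i+1}=G_i\cup\mathrm{output}(\lambda)$,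 $\lambda$ a $\Sigma_M$-trigger loaded and not obsolete for $G_i$. Predicates: binary $\mathsf L_a$ ($a\in\Gamma\cup\{\mathtt B\}$), $\mathsf Q_q$ ($q\in Q$), ternary $\mathsf F,\mathsf R$, binary $\mathsf{C_L},\mathsf{C_R},\mathsf{NextBr},\mathsf{End}$, unary $\mathsf{Real},\mathsf{Brake}$. $\mathrm{brSet}(x,w)$ denotes $\{\mathsf F(x,w,w),\mathsf R(x,w,w),\mathsf{Real}(x),\mathsf{Brake}(w)\}$. $\Sigma_M$ consists of: (Brake) $\mathsf{Brake}(w)\to\bigwedge_{a}\mathsf L_a(w,w)\wedge\bigwedge_{q}\mathsf Q_q(w,w)\wedge\mathsf F(w,w,w)\wedge\mathsf R(w,w,w)\wedge\mathsf{C_L}(w,w)\wedge\mathsf{C_R}(w,w)\wedge\mathsf{Real}(w)\wedge\mathsf{NextBr}(w,w)$; (NextBr) $\mathrm{brSet}(x,w)\wedge\mathsf{NextBr}(w,w')\to\mathrm{brSet}(x,w')$; for $q\ne q_r$ and $(q',b,\rightarrow)\in\delta(q,a)$, $c\in\Gamma\cup\{\mathtt B\}$: $\mathsf Q_q(x,w)\wedge\mathsf L_a(x,w)\wedge\mathsf R(x,y,w)\wedge\mathsf L_c(y,w)\wedge\mathrm{brSet}(x,w)\wedge\mathrm{brSet}(y,w)\to\exists x',y'.\ \mathsf Q_{q'}(y',w)\wedge\mathsf L_c(y',w)\wedge\mathsf L_b(x',w)\wedge\mathsf{C_L}(x',w)\wedge\mathsf{C_R}(y',w)\wedge\mathsf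 R(x',y',w)\wedge\mathsf F(x,x',w)\wedge\mathsf F(y,y',w)\wedge\mathrm{brSet}(x',w)\wedge\mathrm{brSet}(y',w)$; for $q\ne q_r$ and $(q',b,\leftarrow)\in\delta(q,a)$: the same with body atom $\mathsf R(y,x,w)$ instead of $\mathsf R(x,y,w)$ and head atoms $\mathsf{C_L}(y',w),\mathsf{C_R}(x',w),\mathsf R(y',x',w)$ instead of $\mathsf{C_L}(x',w),\mathsf{C_R}(y',w),\mathsf R(x',y',w)$; for $(q',b,\rightarrow)\in\delta(q_r,a)$: $\mathsf Q_{q_r}(x,w)\wedge\mathsf R(x,y,w)\wedge\mathsf L_a(x,w)\wedge\mathsf L_c(y,w)\wedge\mathrm{brSet}(x,w)\wedge\mathrm{brSet}(y,w)\to\exists x',y',w'.\ \mathsf Q_{q'}(y',w')\wedge\mathsf L_c(y',w')\wedge\mathsf L_b(x',w')\wedge\mathsf R(x',y',w')\wedge\mathsf F(x,x',w')\wedge\mathsf F(y,y',w')\wedge\mathsf{C_L}(x',w')\wedge\mathsf{C_R}(y',w')\wedge\mathrm{brSet}(x',w')\wedge\mathrm{brSet}(y',w')\wedge\mathsf{NextBr}(w,w')$; for $(q',b,\leftarrow)\in\delta(q_r,a)$: the same with $\mathsf R(y,x,w)$ in the body and $\mathsf R(y',x',w'),\mathsf{C_L}(y',w'),\mathsf{C_R}(x',w')$ in the head instead; for each $a$: (copy right) $\mathsf{C_R}(x',w')\wedge\mathsf F(x,x',w')\wedge\mathsf R(x,y,w)\wedge\mathsf L_a(y,w)\wedge\mathrm{brSet}(x,w)\wedge\mathrm{brSet}(x',w')\wedge\mathrm{brSet}(y,w)\to\exists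 y'.\ \mathsf F(y,y',w')\wedge\mathsf R(x',y',w')\wedge\mathsf L_a(y',w')\wedge\mathsf{C_R}(y',w')\wedge\mathrm{brSet}(y',w')$ and (copy left) $\mathsf{C_L}(x',w')\wedge\mathsf F(x,x',w')\wedge\mathsf R(y,x,w)\wedge\mathsf L_a(y,w)\wedge\mathrm{brSet}(x,w)\wedge\mathrm{brSet}(x',w')\wedge\mathrm{brSet}(y,w)\to\exists y'.\ \mathsf F(y,y',w')\wedge\mathsf R(y',x',w')\wedge\mathsf L_a(y',w')\wedge\mathsf{C_L}(y',w')\wedge\mathrm{brSet}(y',w')$; (End) $\mathsf{C_R}(x',w')\wedge\mathsf F(x,x',w')\wedge\mathsf{End}(x,w)\wedge\mathrm{brSet}(x,w)\wedge\mathrm{brSet}(x',w')\to\exists y'.\ \mathsf R(x',y',w')\wedge\mathsf L_{\mathtt B}(y',w')\wedge\mathsf{End}(y',w')\wedge\mathrm{brSet}(y',w')$. Wild frontier: a fact set $F$ has a wild frontier of configuration $\rho=\langle n,t,p,q\rangle$ overseen by a term $w$ of $F$ if there are terms $x_1,\dots,x_{n+1}$ of $F$ with: $\mathsf{Real}(w)\notin F$; $\mathsf R(x_i,x_{i+1},w),\mathsf L_{t(i)}(x_i,w)\in F$ for all $1\le i\le n$; $\mathsf Q_q(x_p,w),\mathsf{End}(x_{n+1},w),\mathsf L_{\mathtt B}(x_{n+1},w)\in F$; $\mathrm{brSet}(x_i,w)\subseteq F$ for all $1\le i\le n+1$; and every other atom of $F$ having some $x_i$ as first argument has $w$ as second argument.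 -}

module Defs where

open import Data.Nat using (ℕ; zero; suc; _≤_; _∸_)
open import Data.Fin using (Fin)
open import Data.Maybe using (Maybe; just; nothing)
open import Data.List using (List; []; _∷_; _++_; map; concatMap; allFin)
open import Data.List.Membership.Propositional using (_∈_)
open import Data.List.Relation.Unary.All using (All)
open import Data.List.Relation.Unary.Any using (Any)
open import Data.Product using (Σ; ∃; ∃-syntax; _×_; _,_)
open import Data.Sum using (_⊎_)
open import Relation.Binary.PropositionalEquality using (_≡_; _≢_)
open import Relation.Nullary using (¬_)

-- Machines
--   Q = Fin nQ, Γ = Fin nΓ with nΓ ≥ 2 (symbols 0 and 1 are the first two
--   elements of Γ), Γ ∪ {B} = Maybe Γ with B = nothing.
--   δ(q,a) ⊆ Q × Γ × {←,→} is given as a relation.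

data Dir : Set where
  left right : Dir

Sym : ℕ → Set
Sym nΓ = Maybe (Fin nΓ)

blank : ∀ {nΓ} → Sym nΓ
blank = nothing

record Machine : Set₁ where
  field
    nQ  : ℕ
    nΓ  : ℕ
    two≤nΓ : 2 ≤ nΓ
    q₀  : Fin nQ
    δ   : Fin nQ → Sym nΓ → Fin nQ → Fin nΓ → Dir → Set

-- Configurations ⟨n,t,p,q⟩; tape positions 1..n (values of t outside
-- {1..n} are irrelevant).

record Config (M : Machine) : Set where
  constructor ⟨_,_,_,_⟩
  open Machine M
  field
    n : ℕ
    t : ℕ → Sym nΓ
    p : ℕ
    q : Fin nQ

module _ (M : Machine) where
  open Machine M

  IsConfig : Config M → Set
  IsConfig ρ =
    1 ≤ p × p ≤ n × t n ≡ blank ×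
    (∀ i j → 1 ≤ i → i ≤ j → j ≤ n → t i ≡ blank → t j ≡ blank)
    where open Config ρ

  move : Dir → ℕ → ℕ
  move left  p = p ∸ 1
  move right p = suc p

  -- ρ' ∈ Next_M(ρ)   (configurations equal iff tapes agree on 1..n)
  Next : Config M → Config M → Set
  Next ⟨ n , t , p , q ⟩ ⟨ n' , t' , p' , q' ⟩ =
    ∃[ r ] ∃[ a ] ∃[ d ]
      δ q (t p) r a d × (d ≡ right ⊎ 2 ≤ p) ×
      n' ≡ suc n × t' p ≡ just a × t' (suc n) ≡ blank ×
      (∀ i → 1 ≤ i → i ≤ n → i ≢ p → t' i ≡ t i) ×
      p' ≡ move d p × q' ≡ r

data Atom (nQ nΓ : ℕ) (T : Set) : Set where
  L      : Sym nΓ → T → T → Atom nQ nΓ T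
  Qs     : Fin nQ → T → T → Atom nQ nΓ T
  F R    : T → T → T → Atom nQ nΓ T
  CL CR NextBr End : T → T → Atom nQ nΓ T
  Real Brake : T → Atom nQ nΓ T

module _ {nQ nΓ : ℕ} where
  amap : ∀ {A B : Set} → (A → B) → Atom nQ nΓ A → Atom nQ nΓ B
  amap f (L a x y)      = L a (f x) (f y)
  amap f (Qs q x y)     = Qs q (f x) (f y)
  amap f (F x y z)      = F (f x) (f y) (f z)
  amap f (R x y z)      = R (f x) (f y) (f z)
  amap f (CL x y)       = CL (f x) (f y)
  amap f (CR x y)       = CR (f x) (f y)
  amap f (NextBr x y)   = NextBr (f x) (f y)
  amap f (End x y)      = End (f x) (f y)
  amap f (Real x)       = Real (f x)
  amap f (Brake x)      = Brake (f x)

  args : ∀ {T : Set} → Atom nQ nΓ T → List T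
  args (L a x y)    = x ∷ y ∷ []
  args (Qs q x y)   = x ∷ y ∷ []
  args (F x y z)    = x ∷ y ∷ z ∷ []
  args (R x y z)    = x ∷ y ∷ z ∷ []
  args (CL x y)     = x ∷ y ∷ []
  args (CR x y)     = x ∷ y ∷ []
  args (NextBr x y) = x ∷ y ∷ []
  args (End x y)    = x ∷ y ∷ []
  args (Real x)     = x ∷ []
  args (Brake x)    = x ∷ []

  firstArg : ∀ {T : Set} → Atom nQ nΓ T → T
  firstArg (L a x y)    = x
  firstArg (Qs q x y)   = x
  firstArg (F x y z)    = x
  firstArg (R x y z)    = x
  firstArg (CL x y)     = x
  firstArg (CR x y)     = x
  firstArg (NextBr x y) = x
  firstArg (End x y)    = x
  firstArg (Real x)     = x
  firstArg (Brake x)    = x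

  secondArg : ∀ {T : Set} → Atom nQ nΓ T → Maybe T
  secondArg (L a x y)    = just y
  secondArg (Qs q x y)   = just y
  secondArg (F x y z)    = just y
  secondArg (R x y z)    = just y
  secondArg (CL x y)     = just y
  secondArg (CR x y)     = just y
  secondArg (NextBr x y) = just y
  secondArg (End x y)    = just y
  secondArg (Real x)     = nothing
  secondArg (Brake x)    = nothing

  brSet : ∀ {T : Set} → T → T → List (Atom nQ nΓ T)
  brSet x w = F x w w ∷ R x w w ∷ Real x ∷ Brake w ∷ []

-- Rules: body variables are universal (ℕ); head variables are universal
-- (u i) or existential (e j).

data Var : Set where
  u e : ℕ → Var

record Rule (nQ nΓ : ℕ) : Set where
  constructor _⇒_
  field
    body : List (Atom nQ nΓ ℕ)
    head : List (Atom nQ nΓ Var)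

-- Terms (constants and nulls) are natural numbers; fact sets are finite.
Term : Set
Term = ℕ

module _ (M : Machine) where
  open Machine M

  At : Set → Set
  At = Atom nQ nΓ

  FactSet : Set
  FactSet = List (At Term)

  Occurs : Term → FactSet → Set
  Occurs s G = Any (λ A → s ∈ args A) G

  private
    x y w : ℕ
    x = 0
    y = 1
    w = 2
    x' y' w' : Var
    x' = e 0
    y' = e 1
    w' = e 2

  allSym : List (Sym nΓ)
  allSym = nothing ∷ map just (allFin nΓ)

  brakeRule : Rule nQ nΓ
  brakeRule =
    (Brake 0 ∷ [])
    ⇒ (map (λ a → L a (u 0) (u 0)) allSym
       ++ map (λ q → Qs q (u 0) (u 0)) (allFin nQ)
       ++ F (u 0) (u 0) (u 0) ∷ R (u 0) (u 0) (u 0) ∷ CL (u 0) (u 0)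
          ∷ CR (u 0) (u 0) ∷ Real (u 0) ∷ NextBr (u 0) (u 0) ∷ [])

  nextBrRule : Rule nQ nΓ
  nextBrRule = (brSet 0 1 ++ NextBr 1 2 ∷ []) ⇒ brSet (u 0) (u 2)

  moveRRule : Fin nQ → Sym nΓ → Fin nQ → Fin nΓ → Sym nΓ → Rule nQ nΓ
  moveRRule q a q' b c =
    (Qs q x w ∷ L a x w ∷ R x y w ∷ L c y w ∷ brSet x w ++ brSet y w)
    ⇒ (Qs q' y' (u w) ∷ L c y' (u w) ∷ L (just b) x' (u w) ∷ CL x' (u w)
       ∷ CR y' (u w) ∷ R x' y' (u w) ∷ F (u x) x' (u w) ∷ F (u y) y' (u w)
       ∷ brSet x' (u w) ++ brSet y' (u w))

  moveLRule : Fin nQ → Sym nΓ → Fin nQ → Fin nΓ → Sym nΓ → Rule nQ nΓ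
  moveLRule q a q' b c =
    (Qs q x w ∷ L a x w ∷ R y x w ∷ L c y w ∷ brSet x w ++ brSet y w)
    ⇒ (Qs q' y' (u w) ∷ L c y' (u w) ∷ L (just b) x' (u w) ∷ CL y' (u w)
       ∷ CR x' (u w) ∷ R y' x' (u w) ∷ F (u x) x' (u w) ∷ F (u y) y' (u w)
       ∷ brSet x' (u w) ++ brSet y' (u w))

  -- transition from qr, head moves right (new brake w')
  realRRule : Fin nQ → Sym nΓ → Fin nQ → Fin nΓ → Sym nΓ → Rule nQ nΓ
  realRRule qr a q' b c =
    (Qs qr x w ∷ R x y w ∷ L a x w ∷ L c y w ∷ brSet x w ++ brSet y w)
    ⇒ (Qs q' y' w' ∷ L c y' w' ∷ L (just b) x' w' ∷ R x' y' w'
       ∷ F (u x) x' w' ∷ F (u y) y' w' ∷ CL x' w' ∷ CR y' w'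
       ∷ brSet x' w' ++ brSet y' w' ++ NextBr (u w) w' ∷ [])

  -- transition from qr, head moves left (new brake w')
  realLRule : Fin nQ → Sym nΓ → Fin nQ → Fin nΓ → Sym nΓ → Rule nQ nΓ
  realLRule qr a q' b c =
    (Qs qr x w ∷ R y x w ∷ L a x w ∷ L c y w ∷ brSet x w ++ brSet y w)
    ⇒ (Qs q' y' w' ∷ L c y' w' ∷ L (just b) x' w' ∷ R y' x' w'
       ∷ F (u x) x' w' ∷ F (u y) y' w' ∷ CL y' w' ∷ CR x' w'
       ∷ brSet x' w' ++ brSet y' w' ++ NextBr (u w) w' ∷ [])

  -- copy rules: universal x=0, y=1, w=2, x'=3, w'=4; existential y' = e 0
  copyRRule : Sym nΓ → Rule nQ nΓ
  copyRRule a =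
    (CR 3 4 ∷ F 0 3 4 ∷ R 0 1 2 ∷ L a 1 2 ∷ brSet 0 2 ++ brSet 3 4 ++ brSet 1 2)
    ⇒ (F (u 1) (e 0) (u 4) ∷ R (u 3) (e 0) (u 4) ∷ L a (e 0) (u 4)
       ∷ CR (e 0) (u 4) ∷ brSet (e 0) (u 4))

  copyLRule : Sym nΓ → Rule nQ nΓ
  copyLRule a =
    (CL 3 4 ∷ F 0 3 4 ∷ R 1 0 2 ∷ L a 1 2 ∷ brSet 0 2 ++ brSet 3 4 ++ brSet 1 2)
    ⇒ (F (u 1) (e 0) (u 4) ∷ R (e 0) (u 3) (u 4) ∷ L a (e 0) (u 4)
       ∷ CL (e 0) (u 4) ∷ brSet (e 0) (u 4))

  -- End rule: universal x=0, w=2, x'=3, w'=4; existential y' = e 0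
  endRule : Rule nQ nΓ
  endRule =
    (CR 3 4 ∷ F 0 3 4 ∷ End 0 2 ∷ brSet 0 2 ++ brSet 3 4)
    ⇒ (R (u 3) (e 0) (u 4) ∷ L blank (e 0) (u 4) ∷ End (e 0) (u 4)
       ∷ brSet (e 0) (u 4))

  data ΣM (qr : Fin nQ) : Rule nQ nΓ → Set where
    brake  : ΣM qr brakeRule
    nextBr : ΣM qr nextBrRule
    moveR  : ∀ q a q' b c → q ≢ qr → δ q a q' b right → ΣM qr (moveRRule q a q' b c)
    moveL  : ∀ q a q' b c → q ≢ qr → δ q a q' b left  → ΣM qr (moveLRule q a q' b c)
    realR  : ∀ a q' b c → δ qr a q' b right → ΣM qr (realRRule qr a q' b c)
    realL  : ∀ a q' b c → δ qr a q' b left  → ΣM qr (realLRule qr a q' b c)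
    copyR  : ∀ a → ΣM qr (copyRRule a)
    copyL  : ∀ a → ΣM qr (copyLRule a)
    end    : ΣM qr endRule

  inst : (ℕ → Term) → (ℕ → Term) → Var → Term
  inst σ τ (u i) = σ i
  inst σ τ (e j) = τ j

  Loaded : FactSet → Rule nQ nΓ → (ℕ → Term) → Set
  Loaded G ρ σ = All (λ A → amap σ A ∈ G) (Rule.body ρ)

  Obsolete : FactSet → Rule nQ nΓ → (ℕ → Term) → Set
  Obsolete G ρ σ = ∃[ τ ] All (λ A → amap (inst σ τ) A ∈ G) (Rule.head ρ)

  ExVarOf : ℕ → Rule nQ nΓ → Set
  ExVarOf j ρ = Any (λ A → e j ∈ args A) (Rule.head ρ)

  FreshFor : FactSet → Rule nQ nΓ → (ℕ → Term) → Set
  FreshFor G ρ τ =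
    (∀ j → ExVarOf j ρ → ¬ Occurs (τ j) G) ×
    (∀ j k → ExVarOf j ρ → ExVarOf k ρ → τ j ≡ τ k → j ≡ k)

  output : Rule nQ nΓ → (ℕ → Term) → (ℕ → Term) → FactSet
  output ρ σ τ = map (amap (inst σ τ)) (Rule.head ρ)

  RStep : Fin nQ → FactSet → FactSet → Set
  RStep qr G H =
    ∃[ ρ ] ΣM qr ρ × ∃[ σ ] Loaded G ρ σ × ¬ Obsolete G ρ σ ×
      ∃[ τ ] FreshFor G ρ τ × H ≡ G ++ output ρ σ τ

  data Derivation (qr : Fin nQ) : FactSet → FactSet → Set where
    done : ∀ G → Derivation qr G G
    step : ∀ {G H K} → RStep qr G H → Derivation qr H K → Derivation qr G K

  WildFrontier : FactSet → Config M → Term → Set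
  WildFrontier G ⟨ n , t , p , q ⟩ w =
    Σ (ℕ → Term) λ xs →
      ¬ (Real w ∈ G) ×
      (∀ i → 1 ≤ i → i ≤ n → R (xs i) (xs (suc i)) w ∈ G × L (t i) (xs i) w ∈ G) ×
      Qs q (xs p) w ∈ G × End (xs (suc n)) w ∈ G × L blank (xs (suc n)) w ∈ G ×
      (∀ i → 1 ≤ i → i ≤ suc n → All (_∈ G) (brSet (xs i) w)) ×
      (∀ A → A ∈ G → ∀ i → 1 ≤ i → i ≤ suc n → firstArg A ≡ xs i →
         Listed xs A ⊎ secondArg A ≡ just w)
    where
      Listed : (ℕ → Term) → At Term → Set
      Listed xs A =
        (∃[ i ] 1 ≤ i × i ≤ n × (A ≡ R (xs i) (xs (suc i)) w ⊎ A ≡ L (t i) (xs i) w))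
        ⊎ A ≡ Qs q (xs p) w ⊎ A ≡ End (xs (suc n)) w ⊎ A ≡ L blank (xs (suc n)) w
        ⊎ (∃[ i ] 1 ≤ i × i ≤ suc n × A ∈ brSet (xs i) w)

-- The chase rebuilds the tape of ρ' as a copy of the frontier of ρ. The transition rule at the head
-- copies the head cell and the neighbour it moves to; the copy rules then copy the remaining cells
-- one at a time outwards, following the links F from each cell to its copy and the markers CL, CR
-- at the ends of the copy, and the End rule finally appends a new blank cell. All created nulls lie
-- above every term of F, so each step is fresh. No step is obsolete: the head of the transition rule
-- needs a Real F-successor of the head cell, that of copy-left an R-predecessor of the leftmost copy,
-- and those of copy-right and End a Real R-successor of the rightmost copy. The leftmost copy has
-- no predecessor, and the only other candidates are the overseer itself (through the brake atoms
-- F(x,w,w), R(x,w,w)), which is not Real.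

module Submission where

open import Defs
open import Data.Fin using (Fin)
open import Data.Product using (∃-syntax; _×_)
open import Data.Sum using (_⊎_)
open import Relation.Binary.PropositionalEquality using (_≡_; _≢_)
open import Relation.Nullary using (¬_)

open import Data.Empty using (⊥-elim)
open import Data.Fin using (#_)
open import Data.Fin.Properties using () renaming (_≟_ to _≟ᶠ_)
open import Data.List using (List; []; _∷_; _++_; map; concatMap)
open import Data.List.Extrema.Nat using (max; xs≤max)
open import Data.List.Membership.Propositional using (_∈_; find; lose)
open import Data.List.Membership.Propositional.Properties using (∈-++⁺ˡ; ∈-++⁺ʳ; ∈-++⁻; ∈-lookup)
open import Data.List.Relation.Unary.All as All using (All; []; _∷_)
open import Data.List.Relation.Unary.All.Properties using (++⁺; map⁻)
open import Data.List.Relation.Unary.Any using (Any; here; there)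
open import Data.List.Relation.Unary.Any.Properties using (concatMap⁺)
open import Data.Maybe using (just)
open import Data.Maybe.Properties using (just-injective)
open import Data.Nat using (ℕ; zero; suc; _+_; _≤_; _<_; _∸_; z≤n; s≤s; z<s)
open import Data.Nat.Properties
open import Data.Product using (_,_; proj₁; proj₂)
open import Data.Sum using (inj₁; inj₂; [_,_]′; map₂)
open import Data.Unit using (⊤)
open import Function using (_∘_)
open import Relation.Binary.PropositionalEquality using (refl; sym; trans; cong; subst)
open import Relation.Nullary using (Dec; yes; no)
open import Relation.Nullary.Decidable using (True; toWitness)

Within : ℕ → ℕ → ℕ → Set
Within lo hi i = lo ≤ i × i ≤ hi

Within-lower : ∀ {lo hi i} → Within lo hi i → i ≡ lo ⊎ Within (suc lo) hi i
Within-lower (lo≤i , i≤hi) with m≤n⇒m<n∨m≡n lo≤i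
... | inj₁ lo<i = inj₂ (lo<i , i≤hi)
... | inj₂ refl = inj₁ refl

Within-upper : ∀ {lo hi i} → Within lo (suc hi) i → Within lo hi i ⊎ i ≡ suc hi
Within-upper (lo≤i , i≤hi+1) with m≤n⇒m<n∨m≡n i≤hi+1
... | inj₁ i<hi+1 = inj₁ (lo≤i , ≤-pred i<hi+1)
... | inj₂ refl   = inj₂ refl

Within-pair : ∀ {lo i} → Within lo (suc lo) i → i ≡ lo ⊎ i ≡ suc lo
Within-pair r with Within-lower r
... | inj₁ i≡lo           = inj₁ i≡lo
... | inj₂ (lo<i , i≤lo+1) = inj₂ (≤-antisym i≤lo+1 lo<i)

Within-sucʳ : ∀ {lo hi i} → Within lo hi i → Within lo (suc hi) i
Within-sucʳ (lo≤i , i≤hi) = lo≤i , m≤n⇒m≤1+n i≤hi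

left∈ : ∀ {lo hi} → lo ≤ hi → Within lo hi lo
left∈ lo≤hi = ≤-refl , lo≤hi

right∈ : ∀ {lo hi} → lo ≤ hi → Within lo hi hi
right∈ lo≤hi = lo≤hi , ≤-refl

_◅◅_ : ∀ {M qr G H K} → Derivation M qr G H → Derivation M qr H K → Derivation M qr G K
done _   ◅◅ D = D
step s C ◅◅ D = step s (C ◅◅ D)

assign₃ : Term → Term → Term → ℕ → Term
assign₃ a b c 0 = a
assign₃ a b c 1 = b
assign₃ a b c _ = c

assign₅ : Term → Term → Term → Term → Term → ℕ → Term
assign₅ a b c d f 0 = a
assign₅ a b c d f 1 = b
assign₅ a b c d f 2 = c
assign₅ a b c d f 3 = d
assign₅ a b c d f _ = f

assign₃-injective : ∀ {a b c j k} → a ≢ b → a ≢ c → b ≢ c → j < 3 → k < 3 →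
  assign₃ a b c j ≡ assign₃ a b c k → j ≡ k
assign₃-injective {j = 0} {0} _   _   _   _ _ _  = refl
assign₃-injective {j = 0} {1} a≢b _   _   _ _ eq = ⊥-elim (a≢b eq)
assign₃-injective {j = 0} {2} _   a≢c _   _ _ eq = ⊥-elim (a≢c eq)
assign₃-injective {j = 1} {0} a≢b _   _   _ _ eq = ⊥-elim (a≢b (sym eq))
assign₃-injective {j = 1} {1} _   _   _   _ _ _  = refl
assign₃-injective {j = 1} {2} _   _   b≢c _ _ eq = ⊥-elim (b≢c eq)
assign₃-injective {j = 2} {0} _   a≢c _   _ _ eq = ⊥-elim (a≢c (sym eq))
assign₃-injective {j = 2} {1} _   _   b≢c _ _ eq = ⊥-elim (b≢c (sym eq))
assign₃-injective {j = 2} {2} _   _   _   _ _ _  = refl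
assign₃-injective {j = suc (suc (suc _))} _ _ _ (s≤s (s≤s (s≤s ()))) _ _
assign₃-injective {j = 0} {suc (suc (suc _))} _ _ _ _ (s≤s (s≤s (s≤s ()))) _
assign₃-injective {j = 1} {suc (suc (suc _))} _ _ _ _ (s≤s (s≤s (s≤s ()))) _
assign₃-injective {j = 2} {suc (suc (suc _))} _ _ _ _ (s≤s (s≤s (s≤s ()))) _

VarBelow : ℕ → Var → Set
VarBelow K (u _) = ⊤
VarBelow K (e j) = j < K

varBelow? : ∀ K v → Dec (VarBelow K v)
varBelow? K (u _) = yes _
varBelow? K (e j) = j <? K

module _ {nQ nΓ : ℕ} where

  firstArg∈args : {T : Set} (A : Atom nQ nΓ T) → firstArg A ∈ args A
  firstArg∈args (L _ _ _)    = here refl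
  firstArg∈args (Qs _ _ _)   = here refl
  firstArg∈args (F _ _ _)    = here refl
  firstArg∈args (R _ _ _)    = here refl
  firstArg∈args (CL _ _)     = here refl
  firstArg∈args (CR _ _)     = here refl
  firstArg∈args (NextBr _ _) = here refl
  firstArg∈args (End _ _)    = here refl
  firstArg∈args (Real _)     = here refl
  firstArg∈args (Brake _)    = here refl

  ExistentialsBelow : ℕ → Rule nQ nΓ → Set
  ExistentialsBelow K ρ = All (All (VarBelow K) ∘ args) (Rule.head ρ)

  existentialsBelow? : ∀ K ρ → Dec (ExistentialsBelow K ρ)
  existentialsBelow? K ρ = All.all? (All.all? (varBelow? K) ∘ args) (Rule.head ρ)

  exVar< : ∀ {K j} (hd : List (Atom nQ nΓ Var)) → All (All (VarBelow K) ∘ args) hd →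
    Any (λ A → e j ∈ args A) hd → j < K
  exVar< (_ ∷ _)  (vs ∷ _)    (here e∈)  = All.lookup vs e∈
  exVar< (_ ∷ hd) (_ ∷ below) (there ex) = exVar< hd below ex

module _ (M : Machine) where
  open Machine M

  freshTerm : FactSet M → Term
  freshTerm G = suc (max 0 (concatMap args G))

  occurs⇒<freshTerm : ∀ {s G} → Occurs M s G → s < freshTerm G
  occurs⇒<freshTerm occ = s≤s (All.lookup (xs≤max 0 _) (concatMap⁺ args occ))

  ∈args⇒<freshTerm : ∀ {s A G} → A ∈ G → s ∈ args A → s < freshTerm G
  ∈args⇒<freshTerm A∈G s∈A = occurs⇒<freshTerm (lose A∈G s∈A)

  loaded : ∀ {G} ρ σ → All (_∈ G) (map (amap σ) (Rule.body ρ)) → Loaded M G ρ σ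
  loaded ρ σ = map⁻

  freshFor : ∀ {G τ} K ρ {below : True (existentialsBelow? K ρ)} →
    (∀ j → j < K → ¬ Occurs M (τ j) G) → (∀ {j k} → j < K → k < K → τ j ≡ τ k → j ≡ k) →
    FreshFor M G ρ τ
  freshFor K ρ {below} fresh injective =
    (λ j ex → fresh j (bound ex)) , (λ j k ex ex' → injective (bound ex) (bound ex'))
    where
    bound : ∀ {j} → ExVarOf M j ρ → j < K
    bound = exVar< (Rule.head ρ) (toWitness below)

  freshFor₁ : ∀ {G s} ρ {below : True (existentialsBelow? 1 ρ)} → ¬ Occurs M s G →
    FreshFor M G ρ (λ _ → s)
  freshFor₁ ρ {below} s∉G =
    freshFor 1 ρ {below} (λ _ _ → s∉G) (λ j<1 k<1 _ → trans (n<1⇒n≡0 j<1) (sym (n<1⇒n≡0 k<1)))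

  module Listing (n : ℕ) (t : ℕ → Sym nΓ) (p : ℕ) (q : Fin nQ) (w : Term) (cell : ℕ → Term) where

    -- Definitionally the local `Listed` of WildFrontier: the atoms it requires explicitly.
    Listed : At M Term → Set
    Listed A =
      (∃[ i ] 1 ≤ i × i ≤ n × (A ≡ R (cell i) (cell (suc i)) w ⊎ A ≡ L (t i) (cell i) w))
      ⊎ A ≡ Qs q (cell p) w ⊎ A ≡ End (cell (suc n)) w ⊎ A ≡ L blank (cell (suc n)) w
      ⊎ (∃[ i ] 1 ≤ i × i ≤ suc n × A ∈ brSet (cell i) w)

    listedEdge : ∀ {i} → Within 1 n i → Listed (R (cell i) (cell (suc i)) w)
    listedEdge (a , b) = inj₁ (_ , a , b , inj₁ refl)

    listedLabel : ∀ {i} → Within 1 n i → Listed (L (t i) (cell i) w)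
    listedLabel (a , b) = inj₁ (_ , a , b , inj₂ refl)

    listedState : Listed (Qs q (cell p) w)
    listedState = inj₂ (inj₁ refl)

    listedEnd : Listed (End (cell (suc n)) w)
    listedEnd = inj₂ (inj₂ (inj₁ refl))

    listedEndBlank : Listed (L blank (cell (suc n)) w)
    listedEndBlank = inj₂ (inj₂ (inj₂ (inj₁ refl)))

    listedBrSet : ∀ {i A} → Within 1 (suc n) i → A ∈ brSet (cell i) w → Listed A
    listedBrSet (a , b) A∈ = inj₂ (inj₂ (inj₂ (inj₂ (_ , a , b , A∈))))

    listed-F : ∀ {s z v} → Listed (F s z v) → z ≡ w
    listed-F (inj₁ (_ , _ , _ , inj₁ ()))
    listed-F (inj₁ (_ , _ , _ , inj₂ ()))
    listed-F (inj₂ (inj₁ ()))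
    listed-F (inj₂ (inj₂ (inj₁ ())))
    listed-F (inj₂ (inj₂ (inj₂ (inj₁ ()))))
    listed-F (inj₂ (inj₂ (inj₂ (inj₂ (_ , _ , _ , here refl)))))                  = refl
    listed-F (inj₂ (inj₂ (inj₂ (inj₂ (_ , _ , _ , there (here ()))))))
    listed-F (inj₂ (inj₂ (inj₂ (inj₂ (_ , _ , _ , there (there (here ())))))))
    listed-F (inj₂ (inj₂ (inj₂ (inj₂ (_ , _ , _ , there (there (there (here ()))))))))

  record Frontier (G : FactSet M) (n : ℕ) (t : ℕ → Sym nΓ) (p : ℕ) (q : Fin nQ) (w : Term) : Set where
    field
      cell     : ℕ → Term
      ¬real    : ¬ Real w ∈ G
      edge     : ∀ {i} → Within 1 n i → R (cell i) (cell (suc i)) w ∈ G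
      label    : ∀ {i} → Within 1 n i → L (t i) (cell i) w ∈ G
      state    : Qs q (cell p) w ∈ G
      endCell  : End (cell (suc n)) w ∈ G
      endBlank : L blank (cell (suc n)) w ∈ G
      brakes   : ∀ {i} → Within 1 (suc n) i → All (_∈ G) (brSet (cell i) w)
      closed   : ∀ {A i} → A ∈ G → Within 1 (suc n) i → firstArg A ≡ cell i →
                 Listing.Listed n t p q w cell A ⊎ secondArg A ≡ just w

  module _ {G : FactSet M} {n : ℕ} {t : ℕ → Sym nΓ} {p : ℕ} {q : Fin nQ} {w : Term} where

    wild⇒frontier : WildFrontier M G ⟨ n , t , p , q ⟩ w → Frontier G n t p q w
    wild⇒frontier (cell , ¬real , edgeLabel , state , endCell , endBlank , brakes , closed) = record
      { cell = cell ; ¬real = ¬real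
      ; edge = λ (a , b) → proj₁ (edgeLabel _ a b)
      ; label = λ (a , b) → proj₂ (edgeLabel _ a b)
      ; state = state ; endCell = endCell ; endBlank = endBlank
      ; brakes = λ (a , b) → brakes _ a b
      ; closed = λ A∈G (a , b) → closed _ A∈G _ a b
      }

    frontier⇒wild : Frontier G n t p q w → WildFrontier M G ⟨ n , t , p , q ⟩ w
    frontier⇒wild fr =
      cell , ¬real , (λ i a b → edge (a , b) , label (a , b)) , state , endCell , endBlank
      , (λ i a b → brakes (a , b)) , (λ A A∈G i a b → closed A∈G (a , b))
      where open Frontier fr

    overseer<freshTerm : Frontier G n t p q w → w < freshTerm G
    overseer<freshTerm fr with Frontier.brakes fr {1} (≤-refl , s≤s z≤n)
    ... | _ ∷ _ ∷ _ ∷ Brake∈ ∷ [] = ∈args⇒<freshTerm Brake∈ (here refl)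

module Successor (M : Machine) (qr : Fin (Machine.nQ M)) {G₀ : FactSet M} {n t p q w}
  (fr : Frontier M G₀ n t p q w) (1≤p : 1 ≤ p) (p≤n : p ≤ n)
  (t' : ℕ → Sym (Machine.nΓ M)) (t'-agrees : ∀ i → 1 ≤ i → i ≤ n → i ≢ p → t' i ≡ t i)
  (t'-blank : t' (suc n) ≡ blank) (q' : Fin (Machine.nQ M))
  where

  open Machine M
  open Frontier fr using () renaming
    ( cell to x; ¬real to ¬Real-w; edge to edge₀; label to label₀; state to state₀
    ; endCell to endCell₀; endBlank to endBlank₀; brakes to brakes₀; closed to closed₀ )

  -- Every term of G₀ is below N, so the copies X i of the cells and the new brake N of a
  -- q_r-step are fresh nulls.
  N : Term
  N = freshTerm M G₀

  X : ℕ → Term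
  X i = N + suc i

  N<X : ∀ {i} → N < X i
  N<X = m<m+n _ z<s

  X≢ : ∀ {i s} → s ≤ N → X i ≢ s
  X≢ s≤N eq = <⇒≱ N<X (subst (_≤ N) (sym eq) s≤N)

  X-injective : ∀ {i j} → X i ≡ X j → i ≡ j
  X-injective eq = suc-injective (+-cancelˡ-≡ N _ _ eq)

  ≥N⇒∉G₀ : ∀ {s} → N ≤ s → ¬ Occurs M s G₀
  ≥N⇒∉G₀ N≤s occ = <⇒≱ (occurs⇒<freshTerm M occ) N≤s

  X∉G₀ : ∀ {A i} → A ∈ G₀ → ¬ X i ∈ args A
  X∉G₀ A∈G₀ X∈A = ≥N⇒∉G₀ (<⇒≤ N<X) (lose A∈G₀ X∈A)

  x<N : ∀ {i} → Within 1 (suc n) i → x i < N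
  x<N r with brakes₀ r
  ... | F∈ ∷ _ = ∈args⇒<freshTerm M F∈ (here refl)

  w<N : w < N
  w<N = overseer<freshTerm M fr

  p∈ : Within 1 (suc n) p
  p∈ = 1≤p , m≤n⇒m≤1+n p≤n

  label₀' : ∀ {i} → Within 1 (suc n) i → i ≢ p → L (t' i) (x i) w ∈ G₀
  label₀' {i} (1≤i , i≤n+1) i≢p with m≤n⇒m<n∨m≡n i≤n+1
  ... | inj₁ (s≤s i≤n) =
    subst (λ c → L c (x i) w ∈ G₀) (sym (t'-agrees i 1≤i i≤n i≢p)) (label₀ (1≤i , i≤n))
  ... | inj₂ refl = subst (λ c → L c (x (suc n)) w ∈ G₀) (sym t'-blank) endBlank₀

  F-target≡w : ∀ {i z v} → Within 1 (suc n) i → F (x i) z v ∈ G₀ → z ≡ w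
  F-target≡w r F∈ = [ Listing.listed-F M n t p q w x , just-injective ]′ (closed₀ F∈ r refl)

  F-target-¬Real : ∀ {z v} → F (x p) z v ∈ G₀ → ¬ Real z ∈ G₀
  F-target-¬Real F∈ = subst (λ z → ¬ Real z ∈ G₀) (sym (F-target≡w p∈ F∈)) ¬Real-w

  transitionNulls : ℕ → ℕ → ℕ → Term
  transitionNulls a b = assign₃ (X a) (X b) N

  transitionNulls-≥N : ∀ {a b} j → N ≤ transitionNulls a b j
  transitionNulls-≥N 0 = <⇒≤ N<X
  transitionNulls-≥N 1 = <⇒≤ N<X
  transitionNulls-≥N (suc (suc _)) = ≤-refl

  transitionFresh : ∀ {a b} ρ {below : True (existentialsBelow? 3 ρ)} → a ≢ b →
    FreshFor M G₀ ρ (transitionNulls a b)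
  transitionFresh ρ {below} a≢b =
    freshFor M 3 ρ {below} (λ j _ → ≥N⇒∉G₀ (transitionNulls-≥N j))
      (assign₃-injective (a≢b ∘ X-injective) (X≢ ≤-refl) (X≢ ≤-refl))

  -- W oversees the frontier being built: w after an ordinary step, N after a q_r-step.
  module Rebuild (W : Term) (W≤N : W ≤ N) (¬Real-W : ¬ Real W ∈ G₀) (p' : ℕ) where

    open Listing M (suc n) t' p' q' W X

    data New (lo hi : ℕ) : At M Term → Set where
      L⁺      : ∀ {i} → Within lo hi i → New lo hi (L (t' i) (X i) W)
      Q⁺      : Within lo hi p' → New lo hi (Qs q' (X p') W)
      CL⁺     : ∀ {i} → Within lo hi i → New lo hi (CL (X i) W)
      CR⁺     : ∀ {i} → Within lo hi i → New lo hi (CR (X i) W)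
      R⁺      : ∀ {i} → Within lo hi i → Within lo hi (suc i) → New lo hi (R (X i) (X (suc i)) W)
      F⁺      : ∀ {i} → Within lo hi i → New lo hi (F (x i) (X i) W)
      brF⁺    : ∀ {i} → Within lo hi i → New lo hi (F (X i) W W)
      brR⁺    : ∀ {i} → Within lo hi i → New lo hi (R (X i) W W)
      Real⁺   : ∀ {i} → Within lo hi i → New lo hi (Real (X i))
      Brake⁺  : New lo hi (Brake W)
      NextBr⁺ : New lo hi (NextBr w W)

    New-widen : ∀ {lo hi lo' hi'} → lo' ≤ lo → hi ≤ hi' → ∀ {A} → New lo hi A → New lo' hi' A
    New-widen {lo} {hi} {lo'} {hi'} lo'≤lo hi≤hi' = widen
      where
      within : ∀ {i} → Within lo hi i → Within lo' hi' i
      within (lo≤i , i≤hi) = ≤-trans lo'≤lo lo≤i , ≤-trans i≤hi hi≤hi'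
      widen : ∀ {A} → New lo hi A → New lo' hi' A
      widen (L⁺ r)    = L⁺ (within r)
      widen (Q⁺ r)    = Q⁺ (within r)
      widen (CL⁺ r)   = CL⁺ (within r)
      widen (CR⁺ r)   = CR⁺ (within r)
      widen (R⁺ r r') = R⁺ (within r) (within r')
      widen (F⁺ r)    = F⁺ (within r)
      widen (brF⁺ r)  = brF⁺ (within r)
      widen (brR⁺ r)  = brR⁺ (within r)
      widen (Real⁺ r) = Real⁺ (within r)
      widen Brake⁺    = Brake⁺
      widen NextBr⁺   = NextBr⁺

    brSet-New : ∀ {lo hi i} → Within lo hi i → All (New lo hi) (brSet (X i) W)
    brSet-New r = brF⁺ r ∷ brR⁺ r ∷ Real⁺ r ∷ Brake⁺ ∷ []

    New-Real : ∀ {lo hi s} → New lo hi (Real s) → N < s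
    New-Real (Real⁺ _) = N<X

    New-R : ∀ {lo hi s z v} → New lo hi (R s z v) →
      z ≡ W ⊎ ∃[ i ] Within lo hi i × Within lo hi (suc i) × s ≡ X i × z ≡ X (suc i)
    New-R (R⁺ r r') = inj₂ (_ , r , r' , refl , refl)
    New-R (brR⁺ _)  = inj₁ refl

    Known : ℕ → ℕ → Term → Set
    Known lo hi s = ∀ {j} → s ≡ X j → Within lo hi j

    New-args : ∀ {lo hi A} → 1 ≤ lo → hi ≤ suc n → New lo hi A → All (Known lo hi) (args A)
    New-args {lo} {hi} 1≤lo hi≤n+1 = known
      where
      old : ∀ {s} → s ≤ N → Known lo hi s
      old s≤N eq = ⊥-elim (X≢ s≤N (sym eq))
      copy : ∀ {i} → Within lo hi i → Known lo hi (X i)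
      copy r eq = subst (Within lo hi) (X-injective eq) r
      known : ∀ {A} → New lo hi A → All (Known lo hi) (args A)
      known (L⁺ r)    = copy r ∷ old W≤N ∷ []
      known (Q⁺ r)    = copy r ∷ old W≤N ∷ []
      known (CL⁺ r)   = copy r ∷ old W≤N ∷ []
      known (CR⁺ r)   = copy r ∷ old W≤N ∷ []
      known (R⁺ r r') = copy r ∷ copy r' ∷ old W≤N ∷ []
      known (F⁺ (lo≤i , i≤hi)) =
        old (<⇒≤ (x<N (≤-trans 1≤lo lo≤i , ≤-trans i≤hi hi≤n+1))) ∷ copy (lo≤i , i≤hi) ∷ old W≤N ∷ []
      known (brF⁺ r)  = copy r ∷ old W≤N ∷ old W≤N ∷ []
      known (brR⁺ r)  = copy r ∷ old W≤N ∷ old W≤N ∷ []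
      known (Real⁺ r) = copy r ∷ []
      known Brake⁺    = old W≤N ∷ []
      known NextBr⁺   = old (<⇒≤ w<N) ∷ old W≤N ∷ []

    New-listed : ∀ {A i} → New 1 (suc n) A → firstArg A ≡ X i → Listed A ⊎ secondArg A ≡ just W
    New-listed (L⁺ r)    _  = inj₁ (listedLabel r)
    New-listed (Q⁺ _)    _  = inj₁ listedState
    New-listed (CL⁺ _)   _  = inj₂ refl
    New-listed (CR⁺ _)   _  = inj₂ refl
    New-listed (R⁺ r _)  _  = inj₁ (listedEdge r)
    New-listed (F⁺ r)    eq = ⊥-elim (X≢ (<⇒≤ (x<N r)) (sym eq))
    New-listed (brF⁺ r)  _  = inj₁ (listedBrSet (Within-sucʳ r) (here refl))
    New-listed (brR⁺ r)  _  = inj₁ (listedBrSet (Within-sucʳ r) (there (here refl)))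
    New-listed (Real⁺ r) _  = inj₁ (listedBrSet (Within-sucʳ r) (there (there (here refl))))
    New-listed Brake⁺    eq = ⊥-elim (X≢ W≤N (sym eq))
    New-listed NextBr⁺   eq = ⊥-elim (X≢ (<⇒≤ w<N) (sym eq))

    -- G₀ together with the copy X lo … X hi of the cells lo … hi of the new tape; CL and CR mark
    -- its ends, where the copy rules extend it.
    record Inv (lo hi : ℕ) (G : FactSet M) : Set where
      field
        1≤lo    : 1 ≤ lo
        lo≤p    : lo ≤ p
        p≤hi    : p ≤ hi
        hi≤n+1  : hi ≤ suc n
        ⊇G₀     : ∀ {A} → A ∈ G₀ → A ∈ G
        ⊆G₀∪New : ∀ {A} → A ∈ G → A ∈ G₀ ⊎ New lo hi A
        edge    : ∀ {i} → Within lo hi i → Within lo hi (suc i) → R (X i) (X (suc i)) W ∈ G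
        label   : ∀ {i} → Within lo hi i → L (t' i) (X i) W ∈ G
        brakes  : ∀ {i} → Within lo hi i → All (_∈ G) (brSet (X i) W)
        originˡ : F (x lo) (X lo) W ∈ G
        originʳ : F (x hi) (X hi) W ∈ G
        markˡ   : CL (X lo) W ∈ G
        markʳ   : CR (X hi) W ∈ G
        state   : Qs q' (X p') W ∈ G

    module _ {lo hi G} (I : Inv lo hi G) where
      open Inv I

      ¬Real-W-Inv : ¬ Real W ∈ G
      ¬Real-W-Inv Real∈ with ⊆G₀∪New Real∈
      ... | inj₁ Real∈G₀ = ¬Real-W Real∈G₀
      ... | inj₂ new     = <⇒≱ (New-Real new) W≤N

      ¬leftNeighbour : ∀ {z} → ¬ R z (X lo) W ∈ G
      ¬leftNeighbour R∈ with ⊆G₀∪New R∈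
      ... | inj₁ R∈G₀ = X∉G₀ R∈G₀ (there (here refl))
      ... | inj₂ new with New-R new
      ...   | inj₁ X≡W = X≢ W≤N X≡W
      ...   | inj₂ (i , (lo≤i , _) , _ , _ , X≡X) with X-injective X≡X
      ...     | refl = 1+n≰n lo≤i

      ¬realRightNeighbour : ∀ {z} → R (X hi) z W ∈ G → ¬ Real z ∈ G
      ¬realRightNeighbour R∈ with ⊆G₀∪New R∈
      ... | inj₁ R∈G₀ = ⊥-elim (X∉G₀ R∈G₀ (here refl))
      ... | inj₂ new with New-R new
      ...   | inj₁ refl = ¬Real-W-Inv
      ...   | inj₂ (i , _ , (_ , i+1≤hi) , X≡X , _) with X-injective X≡X
      ...     | refl = ⊥-elim (1+n≰n i+1≤hi)

      X∉outside : ∀ {j} → ¬ Within lo hi j → ¬ Occurs M (X j) G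
      X∉outside outside occ with find occ
      ... | A , A∈G , X∈A with ⊆G₀∪New A∈G
      ...   | inj₁ A∈G₀ = X∉G₀ A∈G₀ X∈A
      ...   | inj₂ new  = outside (All.lookup (New-args 1≤lo hi≤n+1 new) X∈A refl)

    copyLeft : ∀ {m hi G} → 1 ≤ m → Inv (suc m) hi G → ∃[ G' ] RStep M qr G G' × Inv m hi G'
    copyLeft {m} {hi} {G} 1≤m I = G ++ out , chase , I'
      where
      open Inv I
      ρ = copyLRule M (t' m)
      σ = assign₅ (x (suc m)) (x m) w (X (suc m)) W
      out = output M ρ σ (λ _ → X m)
      m+1≤hi : suc m ≤ hi
      m+1≤hi = ≤-trans lo≤p p≤hi
      m≤n : m ≤ n
      m≤n = ≤-trans (n≤1+n m) (≤-trans lo≤p p≤n)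
      chase : RStep M qr G (G ++ out)
      chase = ρ , copyL (t' m) , σ
        , loaded M ρ σ ( markˡ ∷ originˡ ∷ ⊇G₀ (edge₀ (1≤m , m≤n))
                       ∷ ⊇G₀ (label₀' (1≤m , m≤n⇒m≤1+n m≤n) (<⇒≢ lo≤p))
                       ∷ ++⁺ (All.map ⊇G₀ (brakes₀ (s≤s z≤n , s≤s m≤n)))
                           (++⁺ (brakes (left∈ m+1≤hi)) (All.map ⊇G₀ (brakes₀ (1≤m , m≤n⇒m≤1+n m≤n)))))
        , (λ { (_ , _ ∷ R∈ ∷ _) → ¬leftNeighbour I R∈ })
        , (λ _ → X m) , freshFor₁ M ρ (X∉outside I (λ (m+1≤m , _) → 1+n≰n m+1≤m)) , refl
      m∈ : Within m hi m
      m∈ = left∈ (≤-trans (n≤1+n m) m+1≤hi)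
      new : ∀ {A} → A ∈ out → A ∈ G ++ out
      new = ∈-++⁺ʳ G
      old : ∀ {A} → A ∈ G → A ∈ G ++ out
      old = ∈-++⁺ˡ
      I' : Inv m hi (G ++ out)
      I' = record
        { 1≤lo = 1≤m ; lo≤p = ≤-trans (n≤1+n m) lo≤p ; p≤hi = p≤hi ; hi≤n+1 = hi≤n+1
        ; ⊇G₀ = old ∘ ⊇G₀
        ; ⊆G₀∪New = [ map₂ (New-widen (n≤1+n m) ≤-refl) ∘ ⊆G₀∪New
                    , inj₂ ∘ All.lookup (F⁺ m∈ ∷ R⁺ m∈ (n≤1+n m , m+1≤hi) ∷ L⁺ m∈ ∷ CL⁺ m∈ ∷ brSet-New m∈)
                    ]′ ∘ ∈-++⁻ G
        ; edge = λ r r' → [ (λ { refl → new (∈-lookup (# 1)) })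
                          , (λ r₁ → old (edge r₁ (s≤s (proj₁ r) , proj₂ r'))) ]′ (Within-lower r)
        ; label = λ r → [ (λ { refl → new (∈-lookup (# 2)) }) , old ∘ label ]′ (Within-lower r)
        ; brakes = λ r → [ (λ { refl → new (∈-lookup (# 4)) ∷ new (∈-lookup (# 5))
                                     ∷ new (∈-lookup (# 6)) ∷ new (∈-lookup (# 7)) ∷ [] })
                         , All.map old ∘ brakes ]′ (Within-lower r)
        ; originˡ = new (∈-lookup (# 0)) ; originʳ = old originʳ
        ; markˡ = new (∈-lookup (# 3))   ; markʳ = old markʳ
        ; state = old state
        }

    copyRight : ∀ {lo hi G} → hi ≤ n → Inv lo hi G → ∃[ G' ] RStep M qr G G' × Inv lo (suc hi) G'
    copyRight {lo} {hi} {G} hi≤n I = G ++ out , chase , I'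
      where
      open Inv I
      ρ = copyRRule M (t' (suc hi))
      σ = assign₅ (x hi) (x (suc hi)) w (X hi) W
      out = output M ρ σ (λ _ → X (suc hi))
      lo≤hi : lo ≤ hi
      lo≤hi = ≤-trans lo≤p p≤hi
      1≤hi : 1 ≤ hi
      1≤hi = ≤-trans 1≤lo lo≤hi
      chase : RStep M qr G (G ++ out)
      chase = ρ , copyR (t' (suc hi)) , σ
        , loaded M ρ σ ( markʳ ∷ originʳ ∷ ⊇G₀ (edge₀ (1≤hi , hi≤n))
                       ∷ ⊇G₀ (label₀' (s≤s z≤n , s≤s hi≤n) (>⇒≢ (s≤s p≤hi)))
                       ∷ ++⁺ (All.map ⊇G₀ (brakes₀ (1≤hi , m≤n⇒m≤1+n hi≤n)))
                           (++⁺ (brakes (right∈ lo≤hi)) (All.map ⊇G₀ (brakes₀ (s≤s z≤n , s≤s hi≤n)))))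
        , (λ { (_ , _ ∷ R∈ ∷ _ ∷ _ ∷ _ ∷ _ ∷ Real∈ ∷ _) → ¬realRightNeighbour I R∈ Real∈ })
        , (λ _ → X (suc hi)) , freshFor₁ M ρ (X∉outside I (λ (_ , hi+1≤hi) → 1+n≰n hi+1≤hi)) , refl
      hi+1∈ : Within lo (suc hi) (suc hi)
      hi+1∈ = right∈ (m≤n⇒m≤1+n lo≤hi)
      new : ∀ {A} → A ∈ out → A ∈ G ++ out
      new = ∈-++⁺ʳ G
      old : ∀ {A} → A ∈ G → A ∈ G ++ out
      old = ∈-++⁺ˡ
      I' : Inv lo (suc hi) (G ++ out)
      I' = record
        { 1≤lo = 1≤lo ; lo≤p = lo≤p ; p≤hi = m≤n⇒m≤1+n p≤hi ; hi≤n+1 = s≤s hi≤n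
        ; ⊇G₀ = old ∘ ⊇G₀
        ; ⊆G₀∪New = [ map₂ (New-widen ≤-refl (n≤1+n hi)) ∘ ⊆G₀∪New
                    , inj₂ ∘ All.lookup (F⁺ hi+1∈ ∷ R⁺ (Within-sucʳ (right∈ lo≤hi)) hi+1∈ ∷ L⁺ hi+1∈
                                         ∷ CR⁺ hi+1∈ ∷ brSet-New hi+1∈)
                    ]′ ∘ ∈-++⁻ G
        ; edge = λ r r' → [ (λ r₁' → old (edge (proj₁ r , ≤-trans (n≤1+n _) (proj₂ r₁')) r₁'))
                          , (λ { refl → new (∈-lookup (# 1)) }) ]′ (Within-upper r')
        ; label = λ r → [ old ∘ label , (λ { refl → new (∈-lookup (# 2)) }) ]′ (Within-upper r)
        ; brakes = λ r → [ All.map old ∘ brakes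
                         , (λ { refl → new (∈-lookup (# 4)) ∷ new (∈-lookup (# 5))
                                     ∷ new (∈-lookup (# 6)) ∷ new (∈-lookup (# 7)) ∷ [] }) ]′ (Within-upper r)
        ; originˡ = old originˡ ; originʳ = new (∈-lookup (# 0))
        ; markˡ = old markˡ     ; markʳ = new (∈-lookup (# 3))
        ; state = old state
        }

    close : ∀ {G} → Inv 1 (suc n) G → ∃[ G' ] RStep M qr G G' × Frontier M G' (suc n) t' p' q' W
    close {G} I = G ++ out , chase , frontier
      where
      open Inv I
      ρ = endRule M
      σ = assign₅ (x (suc n)) 0 w (X (suc n)) W   -- variable 1 does not occur in the End rule
      out = output M ρ σ (λ _ → X (suc (suc n)))
      chase : RStep M qr G (G ++ out)
      chase = ρ , end , σ
        , loaded M ρ σ ( markʳ ∷ originʳ ∷ ⊇G₀ endCell₀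
                       ∷ ++⁺ (All.map ⊇G₀ (brakes₀ (s≤s z≤n , ≤-refl))) (brakes (s≤s z≤n , ≤-refl)))
        , (λ { (_ , R∈ ∷ _ ∷ _ ∷ _ ∷ _ ∷ Real∈ ∷ _) → ¬realRightNeighbour I R∈ Real∈ })
        , (λ _ → X (suc (suc n))) , freshFor₁ M ρ (X∉outside I (λ (_ , n+2≤n+1) → 1+n≰n n+2≤n+1)) , refl
      new : ∀ {A} → A ∈ out → A ∈ G ++ out
      new = ∈-++⁺ʳ G
      old : ∀ {A} → A ∈ G → A ∈ G ++ out
      old = ∈-++⁺ˡ
      out-unreal : All (_≢ Real W) out
      out-unreal = (λ ()) ∷ (λ ()) ∷ (λ ()) ∷ (λ ()) ∷ (λ ()) ∷ X≢ W≤N ∘ cong firstArg ∷ (λ ()) ∷ []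
      out-listed : All Listed out
      out-listed = listedEdge (s≤s z≤n , ≤-refl) ∷ listedEndBlank ∷ listedEnd
                 ∷ All.tabulate (listedBrSet (s≤s z≤n , ≤-refl))
      closedOld : ∀ {A i} → A ∈ G → firstArg A ≡ X i → Listed A ⊎ secondArg A ≡ just W
      closedOld {A} A∈G first≡X with ⊆G₀∪New A∈G
      ... | inj₁ A∈G₀ = ⊥-elim (X∉G₀ A∈G₀ (subst (_∈ args A) first≡X (firstArg∈args A)))
      ... | inj₂ new  = New-listed new first≡X
      frontier : Frontier M (G ++ out) (suc n) t' p' q' W
      frontier = record
        { cell = X
        ; ¬real = λ Real∈ → [ ¬Real-W-Inv I , (λ m → All.lookup out-unreal m refl) ]′ (∈-++⁻ G Real∈)
        ; edge = λ r → [ (λ (1≤i , i≤n) → old (edge (1≤i , m≤n⇒m≤1+n i≤n) (s≤s z≤n , s≤s i≤n)))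
                       , (λ { refl → new (∈-lookup (# 0)) }) ]′ (Within-upper r)
        ; label = old ∘ label
        ; state = old state
        ; endCell = new (∈-lookup (# 2))
        ; endBlank = new (∈-lookup (# 1))
        ; brakes = λ r → [ All.map old ∘ brakes
                         , (λ { refl → new (∈-lookup (# 3)) ∷ new (∈-lookup (# 4))
                                     ∷ new (∈-lookup (# 5)) ∷ new (∈-lookup (# 6)) ∷ [] }) ]′ (Within-upper r)
        ; closed = λ A∈ _ first≡X → [ (λ A∈G → closedOld A∈G first≡X) , inj₁ ∘ All.lookup out-listed ]′ (∈-++⁻ G A∈)
        }

    extendLeft : ∀ {lo hi G} → Inv lo hi G → ∃[ H ] Derivation M qr G H × Inv 1 hi H
    extendLeft {zero} I with Inv.1≤lo I
    ... | ()
    extendLeft {suc zero} I = _ , done _ , I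
    extendLeft {suc (suc m)} I =
      let G' , chase , I' = copyLeft (s≤s z≤n) I
          H , D , I'' = extendLeft I'
      in H , step chase D , I''

    extendRight : ∀ k {hi G} → k + hi ≡ suc n → Inv 1 hi G → ∃[ H ] Derivation M qr G H × Inv 1 (suc n) H
    extendRight zero refl I = _ , done _ , I
    extendRight (suc k) {hi} k+1+hi≡n+1 I =
      let G' , chase , I' = copyRight (subst (hi ≤_) (suc-injective k+1+hi≡n+1) (m≤n+m hi k)) I
          H , D , I'' = extendRight k (trans (+-suc k hi) k+1+hi≡n+1) I'
      in H , step chase D , I''

    complete : ∀ {lo hi G} → Inv lo hi G → ∃[ H ] Derivation M qr G H × Frontier M H (suc n) t' p' q' W
    complete {hi = hi} I =
      let G₁ , D₁ , I₁ = extendLeft I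
          G₂ , D₂ , I₂ = extendRight (suc n ∸ hi) (m∸n+n≡m (Inv.hi≤n+1 I)) I₁
          G₃ , chase , fr' = close I₂
      in G₃ , D₁ ◅◅ (D₂ ◅◅ step chase (done G₃)) , fr'

    -- What a transition rule outputs: the copies of the head cell and of its neighbour.
    record Window (lo hi : ℕ) (out : FactSet M) : Set where
      field
        new     : All (New lo hi) out
        edge    : R (X lo) (X hi) W ∈ out
        labelˡ  : L (t' lo) (X lo) W ∈ out
        labelʳ  : L (t' hi) (X hi) W ∈ out
        brakesˡ : All (_∈ out) (brSet (X lo) W)
        brakesʳ : All (_∈ out) (brSet (X hi) W)
        originˡ : F (x lo) (X lo) W ∈ out
        originʳ : F (x hi) (X hi) W ∈ out
        markˡ   : CL (X lo) W ∈ out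
        markʳ   : CR (X hi) W ∈ out
        state   : Qs q' (X p') W ∈ out

    windowInv : ∀ {lo hi out} → suc lo ≡ hi → 1 ≤ lo → lo ≤ p → p ≤ hi → hi ≤ suc n →
      Window lo hi out → Inv lo hi (G₀ ++ out)
    windowInv {lo} {out = out} refl 1≤lo lo≤p p≤hi hi≤n+1 win = record
      { 1≤lo = 1≤lo ; lo≤p = lo≤p ; p≤hi = p≤hi ; hi≤n+1 = hi≤n+1
      ; ⊇G₀ = ∈-++⁺ˡ
      ; ⊆G₀∪New = map₂ (All.lookup new) ∘ ∈-++⁻ G₀
      ; edge = λ r (_ , i+1≤lo+1) → [ (λ { refl → in' edge }) , (λ { refl → ⊥-elim (1+n≰n i+1≤lo+1) }) ]′ (Within-pair r)
      ; label = λ r → [ (λ { refl → in' labelˡ }) , (λ { refl → in' labelʳ }) ]′ (Within-pair r)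
      ; brakes = λ r → [ (λ { refl → All.map in' brakesˡ }) , (λ { refl → All.map in' brakesʳ }) ]′ (Within-pair r)
      ; originˡ = in' originˡ ; originʳ = in' originʳ
      ; markˡ = in' markˡ ; markʳ = in' markʳ
      ; state = in' state
      }
      where
      open Window win
      in' : ∀ {A} → A ∈ out → A ∈ G₀ ++ out
      in' = ∈-++⁺ʳ G₀

  p+1∈ : Within 1 (suc n) (suc p)
  p+1∈ = s≤s z≤n , s≤s p≤n

  moveRight : ∀ {b} → q ≢ qr → δ q (t p) q' b right → t' p ≡ just b →
    ∃[ G ] Derivation M qr G₀ G × Frontier M G (suc n) t' (suc p) q' w
  moveRight {b} q≢qr δ∈ t'p = let G , D , fr' = complete I in G , step chase D , fr'
    where
    open Rebuild w (<⇒≤ w<N) ¬Real-w (suc p)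
    ρ = moveRRule M q (t p) q' b (t' (suc p))
    σ = assign₃ (x p) (x (suc p)) w
    out = output M ρ σ (transitionNulls p (suc p))
    chase : RStep M qr G₀ (G₀ ++ out)
    chase = ρ , moveR q (t p) q' b (t' (suc p)) q≢qr δ∈ , σ
      , loaded M ρ σ ( state₀ ∷ label₀ (1≤p , p≤n) ∷ edge₀ (1≤p , p≤n) ∷ label₀' p+1∈ (>⇒≢ ≤-refl)
                     ∷ ++⁺ (brakes₀ p∈) (brakes₀ p+1∈))
      , (λ { (_ , _ ∷ _ ∷ _ ∷ _ ∷ _ ∷ _ ∷ F∈ ∷ _ ∷ _ ∷ _ ∷ Real∈ ∷ _) → F-target-¬Real F∈ Real∈ })
      , transitionNulls p (suc p) , transitionFresh ρ (<⇒≢ ≤-refl) , refl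
    lo∈ = left∈ (n≤1+n p)
    hi∈ = right∈ (n≤1+n p)
    I : Inv p (suc p) (G₀ ++ out)
    I = windowInv refl 1≤p ≤-refl (n≤1+n p) (s≤s p≤n) record
      { new = Q⁺ hi∈ ∷ L⁺ hi∈ ∷ subst (λ c → New p (suc p) (L c (X p) w)) t'p (L⁺ lo∈) ∷ CL⁺ lo∈ ∷ CR⁺ hi∈
            ∷ R⁺ lo∈ hi∈ ∷ F⁺ lo∈ ∷ F⁺ hi∈ ∷ ++⁺ (brSet-New lo∈) (brSet-New hi∈)
      ; state = ∈-lookup (# 0) ; labelʳ = ∈-lookup (# 1)
      ; labelˡ = subst (λ c → L c (X p) w ∈ out) (sym t'p) (∈-lookup (# 2))
      ; markˡ = ∈-lookup (# 3) ; markʳ = ∈-lookup (# 4) ; edge = ∈-lookup (# 5)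
      ; originˡ = ∈-lookup (# 6) ; originʳ = ∈-lookup (# 7)
      ; brakesˡ = ∈-lookup (# 8) ∷ ∈-lookup (# 9) ∷ ∈-lookup (# 10) ∷ ∈-lookup (# 11) ∷ []
      ; brakesʳ = ∈-lookup (# 12) ∷ ∈-lookup (# 13) ∷ ∈-lookup (# 14) ∷ ∈-lookup (# 15) ∷ []
      }

  moveLeft : ∀ {l b} → suc l ≡ p → 1 ≤ l → q ≢ qr → δ q (t p) q' b left → t' p ≡ just b →
    ∃[ G ] Derivation M qr G₀ G × Frontier M G (suc n) t' l q' w
  moveLeft {l} {b} l+1≡p 1≤l q≢qr δ∈ t'p = let G , D , fr' = complete I in G , step chase D , fr'
    where
    open Rebuild w (<⇒≤ w<N) ¬Real-w l
    ρ = moveLRule M q (t p) q' b (t' l)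
    σ = assign₃ (x p) (x l) w
    out = output M ρ σ (transitionNulls p l)
    l≤p : l ≤ p
    l≤p = subst (l ≤_) l+1≡p (n≤1+n l)
    l≤n : l ≤ n
    l≤n = ≤-trans (n≤1+n l) (subst (_≤ n) (sym l+1≡p) p≤n)
    chase : RStep M qr G₀ (G₀ ++ out)
    chase = ρ , moveL q (t p) q' b (t' l) q≢qr δ∈ , σ
      , loaded M ρ σ ( state₀ ∷ label₀ (1≤p , p≤n)
                     ∷ subst (λ k → R (x l) (x k) w ∈ G₀) l+1≡p (edge₀ (1≤l , l≤n))
                     ∷ label₀' (1≤l , m≤n⇒m≤1+n l≤n) (<⇒≢ (≤-reflexive l+1≡p))
                     ∷ ++⁺ (brakes₀ p∈) (brakes₀ (1≤l , m≤n⇒m≤1+n l≤n)))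
      , (λ { (_ , _ ∷ _ ∷ _ ∷ _ ∷ _ ∷ _ ∷ F∈ ∷ _ ∷ _ ∷ _ ∷ Real∈ ∷ _) → F-target-¬Real F∈ Real∈ })
      , transitionNulls p l , transitionFresh ρ (>⇒≢ (≤-reflexive l+1≡p)) , refl
    lo∈ = left∈ l≤p
    hi∈ = right∈ l≤p
    I : Inv l p (G₀ ++ out)
    I = windowInv l+1≡p 1≤l l≤p ≤-refl (m≤n⇒m≤1+n p≤n) record
      { new = Q⁺ lo∈ ∷ L⁺ lo∈ ∷ subst (λ c → New l p (L c (X p) w)) t'p (L⁺ hi∈) ∷ CL⁺ lo∈ ∷ CR⁺ hi∈
            ∷ subst (λ k → New l p (R (X l) (X k) w)) l+1≡p (R⁺ lo∈ (subst (Within l p) (sym l+1≡p) hi∈))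
            ∷ F⁺ hi∈ ∷ F⁺ lo∈ ∷ ++⁺ (brSet-New hi∈) (brSet-New lo∈)
      ; state = ∈-lookup (# 0) ; labelˡ = ∈-lookup (# 1)
      ; labelʳ = subst (λ c → L c (X p) w ∈ out) (sym t'p) (∈-lookup (# 2))
      ; markˡ = ∈-lookup (# 3) ; markʳ = ∈-lookup (# 4) ; edge = ∈-lookup (# 5)
      ; originʳ = ∈-lookup (# 6) ; originˡ = ∈-lookup (# 7)
      ; brakesʳ = ∈-lookup (# 8) ∷ ∈-lookup (# 9) ∷ ∈-lookup (# 10) ∷ ∈-lookup (# 11) ∷ []
      ; brakesˡ = ∈-lookup (# 12) ∷ ∈-lookup (# 13) ∷ ∈-lookup (# 14) ∷ ∈-lookup (# 15) ∷ []
      }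

  ¬Real-N : ¬ Real N ∈ G₀
  ¬Real-N Real∈ = ≥N⇒∉G₀ ≤-refl (lose Real∈ (here refl))

  brakeRight : ∀ {b} → q ≡ qr → δ q (t p) q' b right → t' p ≡ just b →
    ∃[ G ] Derivation M qr G₀ G × Frontier M G (suc n) t' (suc p) q' N
  brakeRight {b} q≡qr δ∈ t'p = let G , D , fr' = complete I in G , step chase D , fr'
    where
    open Rebuild N ≤-refl ¬Real-N (suc p)
    ρ = realRRule M qr (t p) q' b (t' (suc p))
    σ = assign₃ (x p) (x (suc p)) w
    out = output M ρ σ (transitionNulls p (suc p))
    chase : RStep M qr G₀ (G₀ ++ out)
    chase = ρ , realR (t p) q' b (t' (suc p)) (subst (λ k → δ k (t p) q' b right) q≡qr δ∈) , σ
      , loaded M ρ σ ( subst (λ k → Qs k (x p) w ∈ G₀) q≡qr state₀ ∷ edge₀ (1≤p , p≤n)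
                     ∷ label₀ (1≤p , p≤n) ∷ label₀' p+1∈ (>⇒≢ ≤-refl)
                     ∷ ++⁺ (brakes₀ p∈) (brakes₀ p+1∈))
      , (λ { (_ , _ ∷ _ ∷ _ ∷ _ ∷ F∈ ∷ _ ∷ _ ∷ _ ∷ _ ∷ _ ∷ Real∈ ∷ _) → F-target-¬Real F∈ Real∈ })
      , transitionNulls p (suc p) , transitionFresh ρ (<⇒≢ ≤-refl) , refl
    lo∈ = left∈ (n≤1+n p)
    hi∈ = right∈ (n≤1+n p)
    I : Inv p (suc p) (G₀ ++ out)
    I = windowInv refl 1≤p ≤-refl (n≤1+n p) (s≤s p≤n) record
      { new = Q⁺ hi∈ ∷ L⁺ hi∈ ∷ subst (λ c → New p (suc p) (L c (X p) N)) t'p (L⁺ lo∈) ∷ R⁺ lo∈ hi∈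
            ∷ F⁺ lo∈ ∷ F⁺ hi∈ ∷ CL⁺ lo∈ ∷ CR⁺ hi∈ ∷ ++⁺ (brSet-New lo∈) (++⁺ (brSet-New hi∈) (NextBr⁺ ∷ []))
      ; state = ∈-lookup (# 0) ; labelʳ = ∈-lookup (# 1)
      ; labelˡ = subst (λ c → L c (X p) N ∈ out) (sym t'p) (∈-lookup (# 2))
      ; edge = ∈-lookup (# 3) ; originˡ = ∈-lookup (# 4) ; originʳ = ∈-lookup (# 5)
      ; markˡ = ∈-lookup (# 6) ; markʳ = ∈-lookup (# 7)
      ; brakesˡ = ∈-lookup (# 8) ∷ ∈-lookup (# 9) ∷ ∈-lookup (# 10) ∷ ∈-lookup (# 11) ∷ []
      ; brakesʳ = ∈-lookup (# 12) ∷ ∈-lookup (# 13) ∷ ∈-lookup (# 14) ∷ ∈-lookup (# 15) ∷ []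
      }

  brakeLeft : ∀ {l b} → suc l ≡ p → 1 ≤ l → q ≡ qr → δ q (t p) q' b left → t' p ≡ just b →
    ∃[ G ] Derivation M qr G₀ G × Frontier M G (suc n) t' l q' N
  brakeLeft {l} {b} l+1≡p 1≤l q≡qr δ∈ t'p = let G , D , fr' = complete I in G , step chase D , fr'
    where
    open Rebuild N ≤-refl ¬Real-N l
    ρ = realLRule M qr (t p) q' b (t' l)
    σ = assign₃ (x p) (x l) w
    out = output M ρ σ (transitionNulls p l)
    l≤p : l ≤ p
    l≤p = subst (l ≤_) l+1≡p (n≤1+n l)
    l≤n : l ≤ n
    l≤n = ≤-trans (n≤1+n l) (subst (_≤ n) (sym l+1≡p) p≤n)
    chase : RStep M qr G₀ (G₀ ++ out)
    chase = ρ , realL (t p) q' b (t' l) (subst (λ k → δ k (t p) q' b left) q≡qr δ∈) , σ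
      , loaded M ρ σ ( subst (λ k → Qs k (x p) w ∈ G₀) q≡qr state₀
                     ∷ subst (λ k → R (x l) (x k) w ∈ G₀) l+1≡p (edge₀ (1≤l , l≤n))
                     ∷ label₀ (1≤p , p≤n)
                     ∷ label₀' (1≤l , m≤n⇒m≤1+n l≤n) (<⇒≢ (≤-reflexive l+1≡p))
                     ∷ ++⁺ (brakes₀ p∈) (brakes₀ (1≤l , m≤n⇒m≤1+n l≤n)))
      , (λ { (_ , _ ∷ _ ∷ _ ∷ _ ∷ F∈ ∷ _ ∷ _ ∷ _ ∷ _ ∷ _ ∷ Real∈ ∷ _) → F-target-¬Real F∈ Real∈ })
      , transitionNulls p l , transitionFresh ρ (>⇒≢ (≤-reflexive l+1≡p)) , refl
    lo∈ = left∈ l≤p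
    hi∈ = right∈ l≤p
    I : Inv l p (G₀ ++ out)
    I = windowInv l+1≡p 1≤l l≤p ≤-refl (m≤n⇒m≤1+n p≤n) record
      { new = Q⁺ lo∈ ∷ L⁺ lo∈ ∷ subst (λ c → New l p (L c (X p) N)) t'p (L⁺ hi∈)
            ∷ subst (λ k → New l p (R (X l) (X k) N)) l+1≡p (R⁺ lo∈ (subst (Within l p) (sym l+1≡p) hi∈))
            ∷ F⁺ hi∈ ∷ F⁺ lo∈ ∷ CL⁺ lo∈ ∷ CR⁺ hi∈ ∷ ++⁺ (brSet-New hi∈) (++⁺ (brSet-New lo∈) (NextBr⁺ ∷ []))
      ; state = ∈-lookup (# 0) ; labelˡ = ∈-lookup (# 1)
      ; labelʳ = subst (λ c → L c (X p) N ∈ out) (sym t'p) (∈-lookup (# 2))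
      ; edge = ∈-lookup (# 3) ; originʳ = ∈-lookup (# 4) ; originˡ = ∈-lookup (# 5)
      ; markˡ = ∈-lookup (# 6) ; markʳ = ∈-lookup (# 7)
      ; brakesʳ = ∈-lookup (# 8) ∷ ∈-lookup (# 9) ∷ ∈-lookup (# 10) ∷ ∈-lookup (# 11) ∷ []
      ; brakesˡ = ∈-lookup (# 12) ∷ ∈-lookup (# 13) ∷ ∈-lookup (# 14) ∷ ∈-lookup (# 15) ∷ []
      }

proposition4p10 :
  (M : Machine) (qr : Fin (Machine.nQ M)) (F : FactSet M) (ρ ρ' : Config M) (w : Term) →
    IsConfig M ρ → WildFrontier M F ρ w → Next M ρ ρ' →
    ∃[ F' ] Derivation M qr F F' ×
      ((Config.q ρ ≡ qr × ∃[ w' ] w' ≢ w × ¬ Occurs M w' F × WildFrontier M F' ρ' w')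
       ⊎ (Config.q ρ ≢ qr × WildFrontier M F' ρ' w))
proposition4p10 M qr G ⟨ n , t , p , q ⟩ ⟨ _ , t' , _ , _ ⟩ w (1≤p , p≤n , _) wf
  (q' , b , d , δ∈ , legal , refl , t'p , t'-blank , t'-agrees , refl , refl) = byCase (q ≟ᶠ qr) d legal δ∈
  where
  open Successor M qr (wild⇒frontier M wf) 1≤p p≤n t' t'-agrees t'-blank q'

  Outcome : ℕ → Set
  Outcome p' = ∃[ F' ] Derivation M qr G F' ×
    ((q ≡ qr × ∃[ w' ] w' ≢ w × ¬ Occurs M w' G × WildFrontier M F' ⟨ suc n , t' , p' , q' ⟩ w')
    ⊎ (q ≢ qr × WildFrontier M F' ⟨ suc n , t' , p' , q' ⟩ w))

  moved : ∀ {p'} → q ≢ qr → ∃[ F' ] Derivation M qr G F' × Frontier M F' (suc n) t' p' q' w → Outcome p'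
  moved q≢qr (F' , D , fr') = F' , D , inj₂ (q≢qr , frontier⇒wild M fr')

  braked : ∀ {p'} → q ≡ qr → ∃[ F' ] Derivation M qr G F' × Frontier M F' (suc n) t' p' q' N → Outcome p'
  braked q≡qr (F' , D , fr') = F' , D , inj₁ (q≡qr , N , >⇒≢ w<N , ≥N⇒∉G₀ ≤-refl , frontier⇒wild M fr')

  byCase : Dec (q ≡ qr) → ∀ d → d ≡ right ⊎ 2 ≤ p → Machine.δ M q (t p) q' b d → Outcome (move M d p)
  byCase (no q≢qr)  right _ δ∈ = moved q≢qr (moveRight q≢qr δ∈ t'p)
  byCase (yes q≡qr) right _ δ∈ = braked q≡qr (brakeRight q≡qr δ∈ t'p)
  byCase _          left (inj₁ ()) _
  byCase (no q≢qr)  left (inj₂ 2≤p) δ∈ =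
    moved q≢qr (moveLeft (m+[n∸m]≡n 1≤p) (∸-monoˡ-≤ 1 2≤p) q≢qr δ∈ t'p)
  byCase (yes q≡qr) left (inj₂ 2≤p) δ∈ =
    braked q≡qr (brakeLeft (m+[n∸m]≡n 1≤p) (∸-monoˡ-≤ 1 2≤p) q≡qr δ∈ t'p)
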